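{- Let $n \geq 4$, $i \in [n]$, and let $C$ be a cycle in $S_n^{2:i}$. Let $e = (u,v) \in E(C)$ with $u = u_1u_2\cdots u_{n-1}i$. Then: (i) if $v = u\circ(1,2)$, then $e$ has a coupled pair-edge in $S_n^{2:u_1}$ and a coupled pair-edge in $S_n^{2:u_2}$; (ii) if $v = us_k^-$ for some $3 \le k \le n-1$, then $e$ has a coupled pair-edge in $S_n^{2:u_2}$; (iii) if $v = us_k^+$ for some $3 \le k \le n-1$, then $e$ has a coupled pair-edge in $S_n^{2:u_1}$.
   Context: For $n \geq 3$, the split-star network $S_n^2$ is the graph whose vertex set is the set of all permutations of $[n]$, written as strings $x_1x_2\cdots x_n$. For a vertex $u = x_1\cdots x_n$: $u\circ(1,2)$ is the vertex $y_1\cdots y_n$ with $y_1=x_2$, $y_2=x_1$, $y_j=x_j$ for $j\in[3,n]$; for $k \in [3,n]$, $us_k^-$ is the vertex with $y_1 = x_2$, $y_2 = x_k$, $y_k = x_1$, $y_j = x_j$ for $j\in[3,n]\setminus\{k\}$; and $us_k^+$ is the vertex with $y_1 = x_k$, $y_2 = x_1$, $y_k = x_2$, $y_j = x_j$ for $j\in[3,n]\setminus\{k\}$. The edges of $S_n^2$ are exactly the pairs $\{u, u\circ(1,2)\}$, $\{u, us_k^-\}$, $\{u, us_k^+\}$ for $u$ a vertex and $k \in [3,n]$. For $i \in [n]$, $S_n^{2:i}$ is the subgraph induced by all vertices whose last symbol is $i$. For an edge $e=(u,v)$ of $S_n^{2:i}$, a coupled pair-edge of $e$ in $S_n^{2:j}$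 ($j\ne i$) is an edge $(u',v')$ of $S_n^{2:j}$ with $u' \in \{us_n^+, us_n^-\}$ and $v' \in \{vs_n^+, vs_n^-\}$ (so that $\langle u,u',v',v,u\rangle$ is a 4-cycle). -}

module Defs where

open import Data.Nat using (ℕ; suc)
open import Data.Fin using (Fin; zero; suc; fromℕ)
open import Data.Vec using (Vec; lookup; _[_]≔_)
open import Data.List using (List; []; _∷_; _++_; zip)
open import Data.List.Membership.Propositional using (_∈_)
open import Data.List.Relation.Unary.All using (All)
open import Data.List.Relation.Unary.Unique.Propositional using (Unique)
open import Data.Product using (Σ; ∃; _×_; _,_)
open import Data.Sum using (_⊎_)
open import Relation.Binary.PropositionalEquality using (_≡_; _≢_)
open import Relation.Nullary using (¬_)

-- Throughout, n = suc (suc m) (so n ≥ 4 iff m ≥ 2).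
-- Symbols of [n] are represented by Fin n (symbol s ↔ toℕ s + 1),
-- positions 1..n by Fin n (position p ↔ index p - 1).
-- A string x₁⋯xₙ is a Vec (Fin n) n; position k ∈ [3,n] is written
-- suc (suc j) with j : Fin m (k = toℕ j + 3).

Str : ℕ → Set
Str m = Vec (Fin (suc (suc m))) (suc (suc m))

p1 : ∀ {m} → Fin (suc (suc m))
p1 = zero

p2 : ∀ {m} → Fin (suc (suc m))
p2 = suc zero

pn : ∀ {m} → Fin (suc (suc m))
pn {m} = fromℕ (suc m)

pk : ∀ {m} → Fin m → Fin (suc (suc m))
pk j = suc (suc j)

IsPerm : ∀ {m} → Str m → Set
IsPerm {m} x = ∀ (a b : Fin (suc (suc m))) → lookup x a ≡ lookup x b → a ≡ b

swap12 : ∀ {m} → Str m → Str m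
swap12 x = (x [ p1 ]≔ lookup x p2) [ p2 ]≔ lookup x p1

sMinus : ∀ {m} → Fin (suc (suc m)) → Str m → Str m
sMinus k x = ((x [ p1 ]≔ lookup x p2) [ p2 ]≔ lookup x k) [ k ]≔ lookup x p1

sPlus : ∀ {m} → Fin (suc (suc m)) → Str m → Str m
sPlus k x = ((x [ p1 ]≔ lookup x k) [ p2 ]≔ lookup x p1) [ k ]≔ lookup x p2

Gen : ∀ {m} → Str m → Str m → Set
Gen {m} u v = v ≡ swap12 u
  ⊎ Σ (Fin m) (λ j → v ≡ sMinus (pk j) u ⊎ v ≡ sPlus (pk j) u)

Edge : ∀ {m} → Str m → Str m → Set
Edge u v = IsPerm u × IsPerm v × (Gen u v ⊎ Gen v u)

InSub : ∀ {m} → Fin (suc (suc m)) → Str m → Set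
InSub i u = IsPerm u × lookup u pn ≡ i

SubEdge : ∀ {m} → Fin (suc (suc m)) → Str m → Str m → Set
SubEdge i u v = Edge u v × InSub i u × InSub i v

cyclePairs : ∀ {A : Set} → List A → List (A × A)
cyclePairs [] = []
cyclePairs (x ∷ xs) = zip (x ∷ xs) (xs ++ (x ∷ []))

record Cycle {m : ℕ} (i : Fin (suc (suc m))) : Set where
  field
    v₀ v₁ v₂ : Str m
    rest     : List (Str m)
    distinct : Unique (v₀ ∷ v₁ ∷ v₂ ∷ rest)
    edges    : All (λ p → SubEdge i (Data.Product.proj₁ p) (Data.Product.proj₂ p))
                   (cyclePairs (v₀ ∷ v₁ ∷ v₂ ∷ rest))

  verts : List (Str m)
  verts = v₀ ∷ v₁ ∷ v₂ ∷ rest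

EdgeOfCycle : ∀ {m} {i : Fin (suc (suc m))} → Cycle i → Str m → Str m → Set
EdgeOfCycle C u v = (u , v) ∈ cyclePairs (Cycle.verts C) ⊎ (v , u) ∈ cyclePairs (Cycle.verts C)

CoupledPairEdge : ∀ {m} → (i j : Fin (suc (suc m))) → Str m → Str m → Set
CoupledPairEdge {m} i j u v = j ≢ i × Σ (Str m) λ u' → Σ (Str m) λ v' →
  (u' ≡ sPlus pn u ⊎ u' ≡ sMinus pn u) ×
  (v' ≡ sPlus pn v ⊎ v' ≡ sMinus pn v) ×
  SubEdge j u' v'

{-# OPTIONS --safe #-}
-- Each generator s_k^± permutes positions, so it commutes with relabelling symbols and maps
-- permutations to permutations. The coupled pair-edges come from the 4-cycle identities
--   (u∘(1,2)) s_n^± = (u s_n^∓)∘(1,2)   and   (u s_k^∓) s_n^∓ = (u s_n^±) s_k^±   (k ≠ n),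
-- since u s_n^+ and u s_n^- end in u₂ and u₁, both different from the last symbol i of u.
module Submission where

open import Defs
open import Data.Nat using (ℕ; zero; suc; _≤_)
open import Data.Fin using (Fin; fromℕ)
open import Data.Vec using (Vec; _∷_; lookup; map; allFin; _[_]≔_)
open import Data.Vec.Properties
  using ( lookup-map; map-[]≔; []≔-idempotent; []≔-lookup; []≔-commutes
        ; lookup∘update; lookup∘update′; lookup-allFin; map-lookup-allFin )
import Data.List.Relation.Unary.All as All
open import Data.Product using (_×_; _,_)
open import Data.Sum using (inj₁; inj₂)
open import Relation.Nullary.Negation using (contraposition)
open import Relation.Binary.PropositionalEquality
  using (_≡_; _≢_; refl; sym; trans; cong; cong₂; ≢-sym; module ≡-Reasoning)
open ≡-Reasoning

[]≔-[]≔-lookup : ∀ {A : Set} {n} (xs : Vec A n) (i : Fin n) {x : A} →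
                 (xs [ i ]≔ x) [ i ]≔ lookup xs i ≡ xs
[]≔-[]≔-lookup xs i = trans ([]≔-idempotent xs i) ([]≔-lookup xs i)

idStr : ∀ {m} → Str m
idStr = allFin _

Natural : ∀ {m} → (Str m → Str m) → Set
Natural {m} f = ∀ (g : Fin (suc (suc m)) → Fin (suc (suc m))) x → f (map g x) ≡ map g (f x)

module _ {m : ℕ} {f : Str m → Str m} (f-natural : Natural f) where

  lookup-natural : ∀ x p → lookup (f x) p ≡ lookup x (lookup (f idStr) p)
  lookup-natural x p = begin
    lookup (f x) p                         ≡⟨ cong (λ y → lookup (f y) p) (map-lookup-allFin x) ⟨
    lookup (f (map (lookup x) idStr)) p    ≡⟨ cong (λ y → lookup y p) (f-natural (lookup x) idStr) ⟩
    lookup (map (lookup x) (f idStr)) p    ≡⟨ lookup-map p (lookup x) (f idStr) ⟩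
    lookup x (lookup (f idStr) p)          ∎

  -- f permutes positions by σ = lookup (f idStr), and f w ≡ idStr makes lookup w a left inverse of σ.
  IsPerm-natural : (w : Str m) → f w ≡ idStr → (x : Str m) → IsPerm x → IsPerm (f x)
  IsPerm-natural w fw≡id x px a b fxa≡fxb = begin
    a                 ≡⟨ σ-inverse a ⟨
    lookup w (σ a)    ≡⟨ cong (lookup w) (px (σ a) (σ b) xσa≡xσb) ⟩
    lookup w (σ b)    ≡⟨ σ-inverse b ⟩
    b                 ∎
    where
    σ = lookup (f idStr)
    σ-inverse : ∀ p → lookup w (σ p) ≡ p
    σ-inverse p = trans (sym (lookup-natural w p)) (trans (cong (λ y → lookup y p) fw≡id) (lookup-allFin p))
    xσa≡xσb : lookup x (σ a) ≡ lookup x (σ b)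
    xσa≡xσb = trans (sym (lookup-natural x a)) (trans fxa≡fxb (lookup-natural x b))

module _ {m : ℕ} (j : Fin m) where

  sPlus-map : Natural (sPlus (pk j))
  sPlus-map g (a ∷ b ∷ r) = cong₂ _∷_ (lookup-map j g r) (cong (g a ∷_) (sym (map-[]≔ g r j)))

  sMinus-map : Natural (sMinus (pk j))
  sMinus-map g (a ∷ b ∷ r) = cong (g b ∷_) (cong₂ _∷_ (lookup-map j g r) (sym (map-[]≔ g r j)))

  sPlus-sMinus-inverse : (x : Str m) → sPlus (pk j) (sMinus (pk j) x) ≡ x
  sPlus-sMinus-inverse (a ∷ b ∷ r) = cong₂ (λ c s → c ∷ b ∷ s) (lookup∘update j r a) ([]≔-[]≔-lookup r j)

  sMinus-sPlus-inverse : (x : Str m) → sMinus (pk j) (sPlus (pk j) x) ≡ x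
  sMinus-sPlus-inverse (a ∷ b ∷ r) = cong₂ (λ c s → a ∷ c ∷ s) (lookup∘update j r b) ([]≔-[]≔-lookup r j)

  sPlus-IsPerm : (x : Str m) → IsPerm x → IsPerm (sPlus (pk j) x)
  sPlus-IsPerm = IsPerm-natural sPlus-map (sMinus (pk j) idStr) (sPlus-sMinus-inverse idStr)

  sMinus-IsPerm : (x : Str m) → IsPerm x → IsPerm (sMinus (pk j) x)
  sMinus-IsPerm = IsPerm-natural sMinus-map (sPlus (pk j) idStr) (sMinus-sPlus-inverse idStr)

  lookup-sPlus : (x : Str m) → lookup (sPlus (pk j) x) (pk j) ≡ lookup x p2
  lookup-sPlus (a ∷ b ∷ r) = lookup∘update j r b

  lookup-sMinus : (x : Str m) → lookup (sMinus (pk j) x) (pk j) ≡ lookup x p1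
  lookup-sMinus (a ∷ b ∷ r) = lookup∘update j r a

  sPlus-swap12 : (x : Str m) → sPlus (pk j) (swap12 x) ≡ swap12 (sMinus (pk j) x)
  sPlus-swap12 (a ∷ b ∷ r) = refl

  sMinus-swap12 : (x : Str m) → sMinus (pk j) (swap12 x) ≡ swap12 (sPlus (pk j) x)
  sMinus-swap12 (a ∷ b ∷ r) = refl

  module _ {l : Fin m} (j≢l : j ≢ l) where

    sMinus-sMinus : (x : Str m) → sMinus (pk l) (sMinus (pk j) x) ≡ sPlus (pk j) (sPlus (pk l) x)
    sMinus-sMinus (a ∷ b ∷ r) =
      cong₂ _∷_ (sym (lookup∘update′ j≢l r b))
        (cong₂ _∷_ (lookup∘update′ (≢-sym j≢l) r a) ([]≔-commutes r j l j≢l))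

    sPlus-sPlus : (x : Str m) → sPlus (pk l) (sPlus (pk j) x) ≡ sMinus (pk j) (sMinus (pk l) x)
    sPlus-sPlus (a ∷ b ∷ r) =
      cong₂ _∷_ (lookup∘update′ (≢-sym j≢l) r b)
        (cong₂ _∷_ (sym (lookup∘update′ j≢l r a)) ([]≔-commutes r j l j≢l))

EdgeOfCycle-IsPerm : ∀ {m} {i : Fin (suc (suc m))} (C : Cycle i) {u v : Str m} →
                     EdgeOfCycle C u v → IsPerm u × IsPerm v
EdgeOfCycle-IsPerm C (inj₁ uv∈C) with All.lookup (Cycle.edges C) uv∈C
... | (pu , pv , _) , _ = pu , pv
EdgeOfCycle-IsPerm C (inj₂ vu∈C) with All.lookup (Cycle.edges C) vu∈C
... | (pv , pu , _) , _ = pu , pv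

lookup-≢-last : ∀ {m} {i : Fin (suc (suc m))} (u : Str m) (p : Fin (suc (suc m))) →
                IsPerm u → lookup u pn ≡ i → p ≢ pn → lookup u p ≢ i
lookup-≢-last u p pu refl = contraposition (pu p pn)

subEdge : ∀ {m} {j : Fin (suc (suc m))} {u v : Str m} → IsPerm u → IsPerm v → Gen u v →
          lookup u pn ≡ j → lookup v pn ≡ j → SubEdge j u v
subEdge pu pv u→v uj vj = (pu , pv , inj₁ u→v) , (pu , uj) , (pv , vj)

-- For n = m + 3 the last position pn is pk ℓ, so the lemmas above apply with k = n.
module _ {m : ℕ} {i : Fin (suc (suc (suc m)))} where
  private
    ℓ : Fin (suc m)
    ℓ = fromℕ m

  swap12-coupledPairEdges : {u v : Str (suc m)} → IsPerm u → IsPerm v → lookup u pn ≡ i → v ≡ swap12 u →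
                            CoupledPairEdge i (lookup u p1) u v × CoupledPairEdge i (lookup u p2) u v
  swap12-coupledPairEdges {u@(_ ∷ _ ∷ _)} pu pv ui refl =
      ( lookup-≢-last u p1 pu ui (λ ()) , sMinus pn u , sPlus pn (swap12 u) , inj₂ refl , inj₁ refl
      , subEdge (sMinus-IsPerm ℓ u pu) (sPlus-IsPerm ℓ (swap12 u) pv) (inj₁ (sPlus-swap12 ℓ u))
                (lookup-sMinus ℓ u) (lookup-sPlus ℓ (swap12 u)) )
    , ( lookup-≢-last u p2 pu ui (λ ()) , sPlus pn u , sMinus pn (swap12 u) , inj₁ refl , inj₂ refl
      , subEdge (sPlus-IsPerm ℓ u pu) (sMinus-IsPerm ℓ (swap12 u) pv) (inj₁ (sMinus-swap12 ℓ u))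
                (lookup-sPlus ℓ u) (lookup-sMinus ℓ (swap12 u)) )

  sMinus-coupledPairEdge : {u v : Str (suc m)} → IsPerm u → IsPerm v → lookup u pn ≡ i →
                           (j : Fin (suc m)) → pk j ≢ pn → v ≡ sMinus (pk j) u → CoupledPairEdge i (lookup u p2) u v
  sMinus-coupledPairEdge {u@(_ ∷ _ ∷ _)} pu pv ui j k≢n refl =
      lookup-≢-last u p2 pu ui (λ ()) , sPlus pn u , sMinus pn (sMinus (pk j) u) , inj₁ refl , inj₂ refl
    , subEdge (sPlus-IsPerm ℓ u pu) (sMinus-IsPerm ℓ (sMinus (pk j) u) pv) (inj₂ (j , inj₂ (sMinus-sMinus j j≢ℓ u)))
              (lookup-sPlus ℓ u) (lookup-sMinus ℓ (sMinus (pk j) u))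
    where
    j≢ℓ : j ≢ ℓ
    j≢ℓ = contraposition (cong pk) k≢n

  sPlus-coupledPairEdge : {u v : Str (suc m)} → IsPerm u → IsPerm v → lookup u pn ≡ i →
                          (j : Fin (suc m)) → pk j ≢ pn → v ≡ sPlus (pk j) u → CoupledPairEdge i (lookup u p1) u v
  sPlus-coupledPairEdge {u@(_ ∷ _ ∷ _)} pu pv ui j k≢n refl =
      lookup-≢-last u p1 pu ui (λ ()) , sMinus pn u , sPlus pn (sPlus (pk j) u) , inj₂ refl , inj₁ refl
    , subEdge (sMinus-IsPerm ℓ u pu) (sPlus-IsPerm ℓ (sPlus (pk j) u) pv) (inj₂ (j , inj₁ (sPlus-sPlus j j≢ℓ u)))
              (lookup-sMinus ℓ u) (lookup-sPlus ℓ (sPlus (pk j) u))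
    where
    j≢ℓ : j ≢ ℓ
    j≢ℓ = contraposition (cong pk) k≢n

corollary2p9 : (m : ℕ) → 2 ≤ m → (i : Fin (suc (suc m))) → (C : Cycle i) → (u v : Str m) → EdgeOfCycle C u v → lookup u pn ≡ i → (v ≡ swap12 u → CoupledPairEdge i (lookup u p1) u v × CoupledPairEdge i (lookup u p2) u v) × ((j : Fin m) → pk j ≢ pn → v ≡ sMinus (pk j) u → CoupledPairEdge i (lookup u p2) u v) × ((j : Fin m) → pk j ≢ pn → v ≡ sPlus (pk j) u → CoupledPairEdge i (lookup u p1) u v)
corollary2p9 zero ()
corollary2p9 (suc m) _ i C u v uv∈C ui =
  let (pu , pv) = EdgeOfCycle-IsPerm C uv∈C in
  swap12-coupledPairEdges pu pv ui , sMinus-coupledPairEdge pu pv ui , sPlus-coupledPairEdge pu pv ui
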